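{- Let $G$ be the elementary abelian $2$-group of order $n=2^r$. (1) For each integer $h$ with $n/2-1\le h\le n-2$ we have $C_h(G)=h+2$. (2) For each integer $h$ with $4\le h\le n/2-2$ we have $n/2\le C_h(G)\le n/2+h-2$.
   Context: $G$ is written additively. For $A\subseteq G$ and a positive integer $h$, $h\hat{\;}A$ denotes the set of all sums of $h$ pairwise distinct elements of $A$. $C_h(G)=\max\{|A| : A\subseteq G,\ h\hat{\;}A\neq G\}$. -}

module Defs where

open import Data.Nat using (ℕ; _≤_)
open import Data.Bool using (Bool; false; _xor_)
open import Data.Vec using (Vec; replicate; zipWith)
open import Data.List using (List; length; foldr)
open import Data.List.Relation.Unary.Unique.Propositional using (Unique)
open import Data.List.Relation.Binary.Sublist.Propositional using (_⊆_)
open import Data.Product using (Σ; ∃; _×_)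
open import Relation.Binary.PropositionalEquality using (_≡_)
open import Relation.Nullary using (¬_)

G : ℕ → Set
G r = Vec Bool r

0G : ∀ {r} → G r
0G = replicate _ false

_+G_ : ∀ {r} → G r → G r → G r
_+G_ = zipWith _xor_

sumG : ∀ {r} → List (G r) → G r
sumG = foldr _+G_ 0G

-- A finite subset of G is represented by a duplicate-free list; its size is the length.
-- g ∈ h^A : g is the sum of h pairwise distinct elements of A
-- (a duplicate-free sublist B of A with |B| = h and Σ B = g).
InRestrictedSumset : ∀ {r} → ℕ → List (G r) → G r → Set
InRestrictedSumset h A g =
  Σ (List (G _)) λ B → B ⊆ A × Unique B × length B ≡ h × sumG B ≡ g

MissesSome : ∀ {r} → ℕ → List (G r) → Set
MissesSome {r} h A = ∃ λ (g : G r) → ¬ InRestrictedSumset h A g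

IsCh : (r h m : ℕ) → Set
IsCh r h m =
  (Σ (List (G r)) λ A → Unique A × MissesSome h A × length A ≡ m)
  × (∀ (A : List (G r)) → Unique A → MissesSome h A → length A ≤ m)

-- Write n = 2^r and L = |A|. If L > n/2 and g ≠ 0, the sets A and g + A meet, so g is a sum of
-- two distinct elements of A. Applying this to a + g in A ∖ {a} for some a ≠ g, every g is a sum
-- of three distinct elements once L > n/2 + 1; peeling off further elements of A, every g is a sum
-- of k + 3 distinct elements once L > n/2 + k + 1. This gives the upper bound in (2) directly, and
-- in (1) after passing to complements: g is a sum of h distinct elements of A iff ΣA + g is a sum
-- of the other L − h. Conversely, any h + 2 elements miss ΣA, since the complement of the summands
-- would be two distinct elements with sum 0, and a hyperplane misses every element off it, so
-- C_h(G) ≥ n/2. As G is finite, everything is decidable and the maximum C_h(G) exists.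
module Submission where

open import Defs
open import Data.Nat using (ℕ; zero; suc; _≤_; _<_; _+_; _*_; _^_; _⊓_; z≤n; s≤s; _≟_)
open import Data.Nat.Properties
open import Data.Nat.Tactic.RingSolver using (solve-∀)
open import Data.Bool using (true; false; _xor_)
open import Data.Bool.Properties using (xor-assoc; xor-comm; xor-same; xor-identityʳ)
  renaming (_≟_ to _≟ᴮ_)
open import Data.Vec using ([]; _∷_; head)
import Data.Vec.Properties as Vec
open import Data.List using (List; []; _∷_; [_]; length; _++_; map; take)
import Data.List.Properties as List
open import Data.List.Membership.Propositional using (_∈_; _∉_; lose; find)
import Data.List.Membership.Propositional.Properties as ∈
import Data.List.Membership.DecPropositional as DecMembership
open import Data.List.Relation.Unary.All as All using (All; []; _∷_)
import Data.List.Relation.Unary.All.Properties as All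
open import Data.List.Relation.Unary.Any as Any using (here; there)
open import Data.List.Relation.Unary.AllPairs using ([]; _∷_)
open import Data.List.Relation.Unary.Unique.Propositional using (Unique)
import Data.List.Relation.Unary.Unique.Propositional.Properties as Unique
import Data.List.Relation.Unary.Unique.DecPropositional as DecUnique
open import Data.List.Relation.Binary.Sublist.Propositional
  using (_⊆_; []; _∷_; _∷ʳ_; ⊆-refl; ⊆-trans; from∈; minimum)
import Data.List.Relation.Binary.Sublist.Propositional.Properties as Sublist
open import Data.List.Relation.Binary.Permutation.Propositional as ↭ using (_↭_)
import Data.List.Relation.Binary.Permutation.Propositional.Properties as ↭
open import Data.Product using (Σ; ∃; _×_; _,_)
open import Data.Sum using (inj₁; inj₂)
open import Data.Empty using (⊥)
open import Function using (_∘_)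
open import Level using (Level)
open import Relation.Nullary using (¬_; Dec; yes; no; ¬?; contradiction)
open import Relation.Nullary.Decidable using (map′; _×-dec_; _⊎-dec_)
open import Relation.Binary.Definitions using (DecidableEquality)
open import Relation.Binary.PropositionalEquality hiding ([_])
open ≡-Reasoning

private
  variable
    a : Level
    r h m : ℕ

Searchable : Set a → Set (Level.suc a)
Searchable {a} A = {P : A → Set a} → (∀ x → Dec (P x)) → Dec (∃ P)

module _ {A : Set a} where

  Unique-resp-⊇ : {xs ys : List A} → xs ⊆ ys → Unique ys → Unique xs
  Unique-resp-⊇ []         []         = []
  Unique-resp-⊇ (y ∷ʳ τ)   (_ ∷ u)    = Unique-resp-⊇ τ u
  Unique-resp-⊇ (refl ∷ τ) (x∉ys ∷ u) = Sublist.All-resp-⊆ τ x∉ys ∷ Unique-resp-⊇ τ u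

  insert-⊆ : {x : A} {ys zs : List A} → x ∈ ys → x ∉ zs → zs ⊆ ys →
             ∃ λ ws → ws ⊆ ys × ws ↭ x ∷ zs
  insert-⊆ (here refl)  x∉zs (y ∷ʳ τ)   = _ , refl ∷ τ , ↭.refl
  insert-⊆ (here refl)  x∉zs (refl ∷ τ) = contradiction (here refl) x∉zs
  insert-⊆ (there x∈ys) x∉zs (y ∷ʳ τ)   =
    let ws , σ , π = insert-⊆ x∈ys x∉zs τ in ws , y ∷ʳ σ , π
  insert-⊆ (there x∈ys) x∉zs (refl ∷ τ) =
    let ws , σ , π = insert-⊆ x∈ys (x∉zs ∘ there) τ
    in _ , refl ∷ σ , ↭.trans (↭.prep _ π) (↭.swap _ _ ↭.refl)

  unique-subset⇒↭-sublist : {xs ys : List A} → Unique xs → All (_∈ ys) xs →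
                            ∃ λ zs → zs ⊆ ys × zs ↭ xs
  unique-subset⇒↭-sublist []               []              = [] , minimum _ , ↭.refl
  unique-subset⇒↭-sublist u@(_ ∷ uxs) (x∈ys ∷ xs∈ys) =
    let zs , τ , π = unique-subset⇒↭-sublist uxs xs∈ys
        x∉zs = Unique.Unique[x∷xs]⇒x∉xs u ∘ ↭.∈-resp-↭ π
        ws , σ , ρ = insert-⊆ x∈ys x∉zs τ
    in ws , σ , ↭.trans ρ (↭.prep _ π)

  unique-subset-length-≤ : {xs ys : List A} → Unique xs → All (_∈ ys) xs → length xs ≤ length ys
  unique-subset-length-≤ u xs∈ys =
    let zs , τ , π = unique-subset⇒↭-sublist u xs∈ys
    in subst (_≤ _) (↭.↭-length π) (Sublist.length-mono-≤ τ)

  complement : {xs ys : List A} → xs ⊆ ys → List A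
  complement []         = []
  complement (y ∷ʳ τ)   = y ∷ complement τ
  complement (refl ∷ τ) = complement τ

  complement-⊆ : {xs ys : List A} (τ : xs ⊆ ys) → complement τ ⊆ ys
  complement-⊆ []         = []
  complement-⊆ (y ∷ʳ τ)   = refl ∷ complement-⊆ τ
  complement-⊆ (refl ∷ τ) = _ ∷ʳ complement-⊆ τ

  length-complement : {xs ys : List A} (τ : xs ⊆ ys) → length xs + length (complement τ) ≡ length ys
  length-complement []             = refl
  length-complement {xs} (y ∷ʳ τ)  = trans (+-suc (length xs) _) (cong suc (length-complement τ))
  length-complement (refl ∷ τ)     = cong suc (length-complement τ)

  enumeration⇒searchable : (xs : List A) → (∀ x → x ∈ xs) → Searchable A
  enumeration⇒searchable xs complete P? =
    map′ (λ p → let x , _ , px = find p in x , px) (λ (x , px) → lose (complete x) px)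
         (Any.any? P? xs)

  search-length : Searchable A → ∀ n {P : List A → Set a} → (∀ xs → Dec (P xs)) →
                  Dec (∃ λ xs → length xs ≡ n × P xs)
  search-length search zero    P? = map′ (λ p → [] , refl , p) (λ { ([] , refl , p) → p }) (P? [])
  search-length search (suc n) P? =
    map′ (λ (x , xs , len , p) → x ∷ xs , cong suc len , p)
         (λ { (x ∷ xs , refl , p) → x , xs , refl , p })
         (search (λ x → search-length search n (P? ∘ (x ∷_))))

  search-sublist : ∀ ys {P : List A → Set a} → (∀ xs → Dec (P xs)) →
                   Dec (∃ λ xs → xs ⊆ ys × P xs)
  search-sublist []       P? = map′ (λ p → [] , [] , p) (λ { (_ , [] , p) → p }) (P? [])
  search-sublist (y ∷ ys) P? =
    map′ (λ { (inj₁ (xs , τ , p)) → xs , y ∷ʳ τ , p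
            ; (inj₂ (xs , τ , p)) → y ∷ xs , refl ∷ τ , p })
         (λ { (xs , _ ∷ʳ τ , p)      → inj₁ (xs , τ , p)
            ; (_ ∷ xs , refl ∷ τ , p) → inj₂ (xs , τ , p) })
         (search-sublist ys P? ⊎-dec search-sublist ys (P? ∘ (y ∷_)))

greatest : {P : ℕ → Set} → (∀ n → Dec (P n)) → ∀ U → (∀ {n} → P n → n ≤ U) →
           ∃ P → ∃ λ m → P m × (∀ {n} → P n → n ≤ m)
greatest P? zero    bounded (n , pn) = n , pn , λ pn′ → ≤-trans (bounded pn′) z≤n
greatest P? (suc U) bounded p with P? (suc U)
... | yes pU  = suc U , pU , bounded
... | no  ¬pU = greatest P? U (λ pn → ≤-pred (≤∧≢⇒< (bounded pn) λ { refl → ¬pU pn })) p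

+G-assoc : (x y z : G r) → (x +G y) +G z ≡ x +G (y +G z)
+G-assoc = Vec.zipWith-assoc xor-assoc

+G-comm : (x y : G r) → x +G y ≡ y +G x
+G-comm = Vec.zipWith-comm xor-comm

+G-identityˡ : (x : G r) → 0G +G x ≡ x
+G-identityˡ = Vec.zipWith-identityˡ (λ _ → refl)

+G-identityʳ : (x : G r) → x +G 0G ≡ x
+G-identityʳ = Vec.zipWith-identityʳ xor-identityʳ

+G-self : (x : G r) → x +G x ≡ 0G
+G-self []      = refl
+G-self (b ∷ x) = cong₂ _∷_ (xor-same b) (+G-self x)

+G-cancelˡ : (x y : G r) → x +G (x +G y) ≡ y
+G-cancelˡ x y = begin
  x +G (x +G y)  ≡⟨ +G-assoc x x y ⟨
  (x +G x) +G y  ≡⟨ cong (_+G y) (+G-self x) ⟩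
  0G +G y        ≡⟨ +G-identityˡ y ⟩
  y              ∎

+G-cancelʳ : (x y : G r) → (x +G y) +G y ≡ x
+G-cancelʳ x y = trans (+G-comm (x +G y) y) (trans (cong (y +G_) (+G-comm x y)) (+G-cancelˡ y x))

+G-move : {x y z : G r} → x +G y ≡ z → y ≡ x +G z
+G-move {x = x} {y = y} e = trans (sym (+G-cancelˡ x y)) (cong (x +G_) e)

+G≡0⇒≡ : {x y : G r} → x +G y ≡ 0G → x ≡ y
+G≡0⇒≡ {x = x} e = sym (trans (+G-move e) (+G-identityʳ x))

+G-swapˡ : (x y z : G r) → x +G (y +G z) ≡ y +G (x +G z)
+G-swapˡ x y z = begin
  x +G (y +G z)  ≡⟨ +G-assoc x y z ⟨
  (x +G y) +G z  ≡⟨ cong (_+G z) (+G-comm x y) ⟩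
  (y +G x) +G z  ≡⟨ +G-assoc y x z ⟩
  y +G (x +G z)  ∎

_≟G_ : DecidableEquality (G r)
_≟G_ = Vec.≡-dec _≟ᴮ_

sumG-↭ : {xs ys : List (G r)} → xs ↭ ys → sumG xs ≡ sumG ys
sumG-↭ ↭.refl          = refl
sumG-↭ (↭.prep x π)    = cong (x +G_) (sumG-↭ π)
sumG-↭ (↭.swap x y π)  = trans (cong (λ s → x +G (y +G s)) (sumG-↭ π)) (+G-swapˡ x y _)
sumG-↭ (↭.trans π ρ)   = trans (sumG-↭ π) (sumG-↭ ρ)

sumG-complement : {xs ys : List (G r)} (τ : xs ⊆ ys) →
                  sumG xs +G sumG (complement τ) ≡ sumG ys
sumG-complement []                   = +G-identityˡ 0G
sumG-complement {xs = xs} (y ∷ʳ τ)   =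
  trans (+G-swapˡ (sumG xs) y _) (cong (y +G_) (sumG-complement τ))
sumG-complement (_∷_ {x = x} refl τ) =
  trans (+G-assoc x _ _) (cong (x +G_) (sumG-complement τ))

allG : ∀ r → List (G r)
allG zero    = [ [] ]
allG (suc r) = map (false ∷_) (allG r) ++ map (true ∷_) (allG r)

∈-allG : (x : G r) → x ∈ allG r
∈-allG []                 = here refl
∈-allG (false ∷ x)        = ∈.∈-++⁺ˡ (∈.∈-map⁺ (false ∷_) (∈-allG x))
∈-allG {suc r} (true ∷ x) =
  ∈.∈-++⁺ʳ (map (false ∷_) (allG r)) (∈.∈-map⁺ (true ∷_) (∈-allG x))

length-allG : ∀ r → length (allG r) ≡ 2 ^ r
length-allG zero    = refl
length-allG (suc r) = begin
  length (map (false ∷_) (allG r) ++ map (true ∷_) (allG r))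
    ≡⟨ List.length-++ (map (false ∷_) (allG r)) ⟩
  length (map (false ∷_) (allG r)) + length (map (true ∷_) (allG r))
    ≡⟨ cong₂ _+_ (List.length-map (false ∷_) (allG r)) (List.length-map (true ∷_) (allG r)) ⟩
  length (allG r) + length (allG r)  ≡⟨ cong₂ _+_ (length-allG r) (length-allG r) ⟩
  2 ^ r + 2 ^ r                      ≡⟨ cong (2 ^ r +_) (+-identityʳ (2 ^ r)) ⟨
  2 ^ suc r                          ∎

allG-unique : ∀ r → Unique (allG r)
allG-unique zero    = [] ∷ []
allG-unique (suc r) =
  Unique.++⁺ (Unique.map⁺ Vec.∷-injectiveʳ (allG-unique r))
             (Unique.map⁺ Vec.∷-injectiveʳ (allG-unique r))
             λ (v∈false , v∈true) → heads-differ (∈.∈-map⁻ _ v∈false) (∈.∈-map⁻ _ v∈true)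
  where
  heads-differ : {v : G (suc r)} → ∃ (λ x → x ∈ allG r × v ≡ false ∷ x) →
                 ∃ (λ y → y ∈ allG r × v ≡ true ∷ y) → ⊥
  heads-differ (_ , _ , refl) (_ , _ , ())

searchable-G : ∀ r → Searchable (G r)
searchable-G r = enumeration⇒searchable (allG r) ∈-allG

length-unique-≤ : {xs : List (G r)} → Unique xs → length xs ≤ 2 ^ r
length-unique-≤ {r} {xs} u =
  subst (length xs ≤_) (length-allG r) (unique-subset-length-≤ u (All.tabulate λ {x} _ → ∈-allG x))

HasMissingSet : (r h m : ℕ) → Set
HasMissingSet r h m = Σ (List (G r)) λ A → Unique A × MissesSome h A × length A ≡ m

InRestrictedSumset? : ∀ h (A : List (G r)) g → Dec (InRestrictedSumset h A g)
InRestrictedSumset? h A g =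
  search-sublist A λ B → DecUnique.unique? _≟G_ B ×-dec (length B ≟ h) ×-dec (sumG B ≟G g)

HasMissingSet? : ∀ r h m → Dec (HasMissingSet r h m)
HasMissingSet? r h m =
  map′ (λ (A , len , u , ms) → A , u , ms , len) (λ (A , u , ms , len) → A , len , u , ms)
       (search-length (searchable-G r) m λ A →
          DecUnique.unique? _≟G_ A ×-dec searchable-G r (¬? ∘ InRestrictedSumset? h A))

C-exists : HasMissingSet r h m → ∃ λ C → IsCh r h C
C-exists {r} {h} w =
  let C , missing , maximal =
        greatest (HasMissingSet? r h) (2 ^ r) (λ { (_ , u , _ , refl) → length-unique-≤ u }) (_ , w)
  in C , missing , λ A u ms → maximal (A , u , ms , refl)

sumset-extend : {A A′ : List (G r)} {x g : G r} → Unique A → A′ ⊆ A → x ∈ A → x ∉ A′ →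
                InRestrictedSumset h A′ (x +G g) → InRestrictedSumset (suc h) A g
sumset-extend {x = x} {g} u σ x∈A x∉A′ (B , τ , _ , refl , sumB) =
  let ws , ω , π = insert-⊆ x∈A (x∉A′ ∘ Sublist.Any-resp-⊆ τ) (⊆-trans τ σ)
  in ws , ω , Unique-resp-⊇ ω u , ↭.↭-length π ,
     trans (sumG-↭ π) (trans (cong (x +G_) sumB) (+G-cancelˡ x g))

sumset-complement : {A : List (G r)} {g : G r} → Unique A → m + h ≡ length A →
                    InRestrictedSumset m A (sumG A +G g) → InRestrictedSumset h A g
sumset-complement {A = A} {g} u len (B , τ , _ , refl , sumB) =
  complement τ , complement-⊆ τ , Unique-resp-⊇ (complement-⊆ τ) u ,
  +-cancelˡ-≡ (length B) _ _ (trans (length-complement τ) (sym len)) , sum-complement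
  where
  sum-complement : sumG (complement τ) ≡ g
  sum-complement = begin
    sumG (complement τ)            ≡⟨ +G-move (sumG-complement τ) ⟩
    sumG B +G sumG A               ≡⟨ cong (_+G sumG A) sumB ⟩
    (sumG A +G g) +G sumG A        ≡⟨ +G-comm _ (sumG A) ⟩
    sumG A +G (sumG A +G g)        ≡⟨ +G-cancelˡ (sumG A) g ⟩
    g                              ∎

nonzero∈sumset-two : {A : List (G r)} {g : G r} → Unique A → 2 ^ r < 2 * length A → g ≢ 0G →
                     InRestrictedSumset 2 A g
nonzero∈sumset-two {r} {A} {g} u big g≢0 with Any.any? (λ x → DecMembership._∈?_ _≟G_ (g +G x) A) A
... | yes p =
  let x , x∈A , g+x∈A = find p
      x≢g+x : x ≢ g +G x
      x≢g+x e = g≢0 (trans (sym (+G-cancelʳ g x)) (trans (cong (_+G x) (sym e)) (+G-self x)))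
  in sumset-extend u (from∈ g+x∈A) x∈A (λ { (here e) → x≢g+x e })
       ([ g +G x ] , ⊆-refl , [] ∷ [] , refl ,
        trans (+G-identityʳ (g +G x)) (+G-comm g x))
... | no none = contradiction (length-unique-≤ unique-A+gA) (<⇒≱ (subst (2 ^ r <_) length-A+gA big))
  where
  unique-A+gA : Unique (A ++ map (g +G_) A)
  unique-A+gA = Unique.++⁺ u (Unique.map⁺ g+-injective u) λ (v∈A , v∈gA) →
    let y , y∈A , v≡g+y = ∈.∈-map⁻ (g +G_) v∈gA
    in none (lose v∈A (subst (_∈ A) (sym (trans (cong (g +G_) v≡g+y) (+G-cancelˡ g y))) y∈A))
    where
    g+-injective : {x y : G r} → g +G x ≡ g +G y → x ≡ y
    g+-injective {x} {y} e = trans (sym (+G-cancelˡ g x)) (trans (cong (g +G_) e) (+G-cancelˡ g y))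
  length-A+gA : 2 * length A ≡ length (A ++ map (g +G_) A)
  length-A+gA = begin
    2 * length A                        ≡⟨ cong (length A +_) (+-identityʳ (length A)) ⟩
    length A + length A                 ≡⟨ cong (length A +_) (List.length-map (g +G_) A) ⟨
    length A + length (map (g +G_) A)   ≡⟨ List.length-++ A ⟨
    length (A ++ map (g +G_) A)         ∎

m+2<2[1+n]⇒m<2n : ∀ m n → m + 2 < 2 * suc n → m < 2 * n
m+2<2[1+n]⇒m<2n m n lt =
  +-cancelʳ-< 2 m (2 * n) (subst (m + 2 <_) (trans (*-suc 2 n) (+-comm 2 (2 * n))) lt)

∈sumset-three : {A : List (G r)} → Unique A → 2 ^ r + 2 < 2 * length A →
                ∀ g → InRestrictedSumset 3 A g
∈sumset-three {A = []}    u () g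
∈sumset-three {r} {A = _ ∷ []} u (s≤s big) g =
  contradiction (m+n≤o⇒n≤o (2 ^ r) big) λ { (s≤s ()) }
∈sumset-three {r} {A = a ∷ b ∷ A₁} u@((a≢b ∷ a∉A₁) ∷ ub@(_ ∷ uA₁)) big g with a ≟G g
... | no a≢g   = sumset-extend u (a ∷ʳ ⊆-refl) (here refl) (Unique.Unique[x∷xs]⇒x∉xs u)
                   (nonzero∈sumset-two ub big′ (a≢g ∘ +G≡0⇒≡))
  where big′ = m+2<2[1+n]⇒m<2n (2 ^ r) (suc (length A₁)) big
... | yes refl = sumset-extend u (refl ∷ (b ∷ʳ ⊆-refl)) (there (here refl)) b∉a∷A₁
                   (nonzero∈sumset-two (a∉A₁ ∷ uA₁) big′ (a≢b ∘ sym ∘ +G≡0⇒≡))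
  where
  big′ = m+2<2[1+n]⇒m<2n (2 ^ r) (suc (length A₁)) big
  b∉a∷A₁ : b ∉ a ∷ A₁
  b∉a∷A₁ (here b≡a)   = a≢b (sym b≡a)
  b∉a∷A₁ (there b∈A₁) = Unique.Unique[x∷xs]⇒x∉xs ub b∈A₁

∈sumset-many : {A : List (G r)} → Unique A → ∀ k → 2 ^ r + 2 * k + 2 < 2 * length A →
               ∀ g → InRestrictedSumset (3 + k) A g
∈sumset-many {r} {A} u zero big =
  ∈sumset-three u (subst (λ n → n + 2 < 2 * length A) (+-identityʳ (2 ^ r)) big)
∈sumset-many {A = []}     u (suc k) () g
∈sumset-many {r} {A = a ∷ A′} u@(_ ∷ u′) (suc k) big g =
  sumset-extend u (a ∷ʳ ⊆-refl) (here refl) (Unique.Unique[x∷xs]⇒x∉xs u)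
    (∈sumset-many u′ k (m+2<2[1+n]⇒m<2n _ (length A′) big′) (a +G g))
  where
  shift : ∀ n k → n + 2 * suc k + 2 ≡ (n + 2 * k + 2) + 2
  shift = solve-∀
  big′ = subst (_< 2 * suc (length A′)) (shift (2 ^ r) k) big

zero∉sumset-two : {A : List (G r)} → ¬ InRestrictedSumset 2 A 0G
zero∉sumset-two (x ∷ y ∷ [] , _ , (x≢y ∷ []) ∷ _ , refl , sum) =
  x≢y (+G≡0⇒≡ (trans (cong (x +G_) (sym (+G-identityʳ y))) sum))

sum∉sumset : {A : List (G r)} → Unique A → h + 2 ≡ length A → ¬ InRestrictedSumset h A (sumG A)
sum∉sumset {A = A} u len p =
  zero∉sumset-two (sumset-complement u len (subst (InRestrictedSumset _ A) (sym (+G-identityʳ _)) p))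

initial-segment-missing : h + 2 ≤ 2 ^ r → HasMissingSet r h (h + 2)
initial-segment-missing {h} {r} fits = A , u , (sumG A , sum∉sumset u (sym len)) , len
  where
  A = take (h + 2) (allG r)
  u = Unique.take⁺ (h + 2) (allG-unique r)
  len : length A ≡ h + 2
  len = trans (List.length-take (h + 2) (allG r))
              (trans (cong ((h + 2) ⊓_) (length-allG r)) (m≤n⇒m⊓n≡m fits))

head-+G : (x y : G (suc r)) → head (x +G y) ≡ head x xor head y
head-+G (_ ∷ _) (_ ∷ _) = refl

head-sumG : {B : List (G (suc r))} → All (λ x → head x ≡ false) B → head (sumG B) ≡ false
head-sumG []                  = refl
head-sumG {B = x ∷ B} (hx ∷ hB) = trans (head-+G x (sumG B)) (cong₂ _xor_ hx (head-sumG hB))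

hyperplane-missing : ∀ r h → HasMissingSet (suc r) h (2 ^ r)
hyperplane-missing r h =
  H , Unique.map⁺ Vec.∷-injectiveʳ (allG-unique r) , (true ∷ 0G , off-H) ,
  trans (List.length-map (false ∷_) (allG r)) (length-allG r)
  where
  H = map (false ∷_) (allG r)
  off-H : ¬ InRestrictedSumset h H (true ∷ 0G)
  off-H (B , τ , _ , _ , sum) =
    contradiction (trans (sym (cong head sum)) (head-sumG (Sublist.All-resp-⊆ τ H-heads))) λ ()
    where
    H-heads : All (λ x → head x ≡ false) H
    H-heads = All.map⁺ (All.universal (λ _ → refl) (allG r))

half-missing : 2 ≤ 2 ^ r → ∃ λ m → HasMissingSet r h m × 2 ^ r ≤ 2 * m
half-missing {zero}      (s≤s ())
half-missing {suc r} {h} _ = 2 ^ r , hyperplane-missing r h , ≤-refl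

IsCh-≥ : {C : ℕ} → IsCh r h C → HasMissingSet r h m → m ≤ C
IsCh-≥ (_ , maximal) (A , u , ms , refl) = maximal A u ms

∈sumset-by-complement : {A : List (G r)} → 2 ^ r ≤ 2 * h + 2 → Unique A → h + 2 < length A →
                ∀ g → InRestrictedSumset h A g
∈sumset-by-complement {r} {h} {A} small u big g =
  let t , len = m≤n⇒∃[o]m+o≡n big
  in sumset-complement u (trans (reorder h t) len)
       (∈sumset-many u t (subst (λ L → 2 ^ r + 2 * t + 2 < 2 * L) len (bound t)) (sumG A +G g))
  where
  reorder : ∀ h t → 3 + t + h ≡ suc (h + 2) + t
  reorder = solve-∀
  expand : ∀ h t → 2 * (suc (h + 2) + t) ≡ (2 * h + 2 + 2 * t + 2) + 2
  expand = solve-∀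
  bound : ∀ t → 2 ^ r + 2 * t + 2 < 2 * (suc (h + 2) + t)
  bound t = subst (2 ^ r + 2 * t + 2 <_) (sym (expand h t))
    (≤-<-trans (+-monoˡ-≤ 2 (+-monoˡ-≤ (2 * t) small)) (m<m+n _ (s≤s z≤n)))

misses⇒length≤h+2 : 2 ^ r ≤ 2 * h + 2 → {A : List (G r)} → Unique A → MissesSome h A →
                    length A ≤ h + 2
misses⇒length≤h+2 small u (g , g∉) = ≮⇒≥ λ big → g∉ (∈sumset-by-complement small u big g)

misses⇒2*length+4≤2^r+2*h : 3 ≤ h → {A : List (G r)} → Unique A → MissesSome h A →
                            2 * length A + 4 ≤ 2 ^ r + 2 * h
misses⇒2*length+4≤2^r+2*h {r = r} (s≤s (s≤s (s≤s {n = k} z≤n))) {A} u (g , g∉) =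
  subst (2 * length A + 4 ≤_) (expand (2 ^ r) k)
        (+-monoˡ-≤ 4 (≮⇒≥ λ big → g∉ (∈sumset-many u k big g)))
  where
  expand : ∀ n k → n + 2 * k + 2 + 4 ≡ n + 2 * (3 + k)
  expand = solve-∀

theorem2p9 : (r : ℕ)
    → (∀ (h : ℕ) → 1 ≤ h → 2 ^ r ≤ 2 * h + 2 → h + 2 ≤ 2 ^ r → IsCh r h (h + 2))
      × (∀ (h : ℕ) → 4 ≤ h → 2 * h + 4 ≤ 2 ^ r
           → Σ ℕ λ m → IsCh r h m × 2 ^ r ≤ 2 * m × 2 * m + 4 ≤ 2 ^ r + 2 * h)
theorem2p9 r = part1 , part2
  where
  part1 : ∀ h → 1 ≤ h → 2 ^ r ≤ 2 * h + 2 → h + 2 ≤ 2 ^ r → IsCh r h (h + 2)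
  part1 h _ small fits = initial-segment-missing fits , λ A u ms → misses⇒length≤h+2 small u ms

  part2 : ∀ h → 4 ≤ h → 2 * h + 4 ≤ 2 ^ r →
          Σ ℕ λ m → IsCh r h m × 2 ^ r ≤ 2 * m × 2 * m + 4 ≤ 2 ^ r + 2 * h
  part2 h 4≤h large =
    let m₀ , w , half = half-missing (≤-trans (s≤s (s≤s z≤n)) (m+n≤o⇒n≤o (2 * h) large))
        C , isCh = C-exists w
        (A , u , ms , len) , _ = isCh
    in C , isCh , ≤-trans half (*-monoʳ-≤ 2 (IsCh-≥ isCh w)) ,
       subst (λ L → 2 * L + 4 ≤ 2 ^ r + 2 * h) len
             (misses⇒2*length+4≤2^r+2*h (≤-trans (n≤1+n 3) 4≤h) u ms)
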